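{- Let $\mathcal X$ be a coherent configuration. Suppose that for every algebraic isomorphism $\varphi$ from $\mathcal X$ onto another coherent configuration, each $\varphi$-faithful map is $\varphi$-extendable. Then $\mathcal X$ is schurian and separable.
   Context: A coherent configuration is a pair $(\Omega,S)$ where $\Omega$ is a finite set and $S$ is a partition of $\Omega\times\Omega$ (basis relations) such that $1_\Omega$ is a union of basis relations, $s^*=\{(\beta,\alpha):(\alpha,\beta)\in s\}\in S$ for all $s\in S$, and for all $r,s,t\in S$ the number $c^t_{rs}=|\alpha r\cap\beta s^*|$ is independent of $(\alpha,\beta)\in t$, where $\alpha r=\{\beta:(\alpha,\beta)\in r\}$. For $\alpha,\beta\in\Omega$, $r(\alpha,\beta)$ denotes the basis relation containing $(\alpha,\beta)$. An algebraic isomorphism from $(\Omega,S)$ to $(\Omega',S')$ is a bijection $\varphi:S\to S'$ with $c^t_{rs}=c^{\varphi(t)}_{\varphi(r)\varphi(s)}$ for all $r,s,t$ (the identity map of $S$ is one from the configuration to itself). A bijection $f$ from a subset of $\Omega$ onto a subset of $\Omega'$ is $\varphi$-faithful if $\varphi(r(\alpha,\beta))=r'(\alpha^f,\beta^f)$ for all $\alpha,\beta$ in the domain of $f$; it is $\varphi$-extendable if for every $\gamma\in\Omega$ there is a $\varphi$-faithful map with domain $\mathrm{dom}(f)\cup\{\gamma\}$ extending $f$. The configuration is schurian if $S$ is the set of orbits on $\Omega\times\Omega$ of some permutation group on $\Omega$; it is separable if for every algebraic isomorphism $\varphi:S\to S'$ there is a bijection $f:\Omega\to\Omega'$ with $\{(\alpha^f,\beta^f):(\alpha,\beta)\in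 s\}=\varphi(s)$ for all $s\in S$. -}

module Defs where

open import Data.Nat using (ℕ)
open import Data.Fin using (Fin; _≟_)
open import Data.Fin.Permutation using (Permutation; Permutation′; _⟨$⟩ʳ_; _∘ₚ_; flip; id)
open import Data.List using (length; filter; allFin)
open import Data.Maybe using (Maybe; just; nothing)
open import Data.Product using (Σ; ∃; ∃-syntax; _×_; _,_)
open import Relation.Nullary using (¬_)
open import Relation.Nullary.Decidable using (_×-dec_)
open import Relation.Binary.PropositionalEquality using (_≡_)

-- The partition S of Ω×Ω is given by its "colour" map R : Ω → Ω → Fin m:
-- the basis relation with index t is {(α,β) : R α β ≡ t}.
record CoherentConfiguration (n m : ℕ) : Set where
  field
    R : Fin n → Fin n → Fin m
    nonempty : ∀ (t : Fin m) → ∃[ α ] ∃[ β ] R α β ≡ t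
    -- 1_Ω is a union of basis relations
    diagonal : ∀ α β γ → R α α ≡ R β γ → β ≡ γ
    -- s* is a basis relation, for every s
    converse : ∀ (s : Fin m) → ∃[ s* ] (∀ α β → R α β ≡ s → R β α ≡ s*)
                                      × (∀ α β → R β α ≡ s* → R α β ≡ s)
open CoherentConfiguration public

-- |α r ∩ β s*| = #{γ : (α,γ) ∈ r and (γ,β) ∈ s}
count : ∀ {n m} → CoherentConfiguration n m → Fin n → Fin n → Fin m → Fin m → ℕ
count X α β r s = length (filter (λ γ → (R X α γ ≟ r) ×-dec (R X γ β ≟ s)) (allFin _))

IntersectionNumberIs : ∀ {n m} → CoherentConfiguration n m → Fin m → Fin m → Fin m → ℕ → Set
IntersectionNumberIs X r s t c = ∀ α β → R X α β ≡ t → count X α β r s ≡ c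

IsCoherent : ∀ {n m} → CoherentConfiguration n m → Set
IsCoherent {m = m} X = ∀ (r s t : Fin m) → ∃[ c ] IntersectionNumberIs X r s t c

IsAlgebraicIso : ∀ {n m n' m'} → CoherentConfiguration n m → CoherentConfiguration n' m'
               → Permutation m m' → Set
IsAlgebraicIso {m = m} X X' φ =
  ∀ (r s t : Fin m) (c : ℕ) →
    IntersectionNumberIs X r s t c → IntersectionNumberIs X' (φ ⟨$⟩ʳ r) (φ ⟨$⟩ʳ s) (φ ⟨$⟩ʳ t) c

IsPartialInjection : ∀ {n n'} → (Fin n → Maybe (Fin n')) → Set
IsPartialInjection f = ∀ α β a → f α ≡ just a → f β ≡ just a → α ≡ β

IsFaithful : ∀ {n m n' m'} → CoherentConfiguration n m → CoherentConfiguration n' m'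
           → Permutation m m' → (Fin n → Maybe (Fin n')) → Set
IsFaithful X X' φ f =
  IsPartialInjection f ×
  (∀ α β a b → f α ≡ just a → f β ≡ just b → φ ⟨$⟩ʳ R X α β ≡ R X' a b)

ExtendsAt : ∀ {n n'} → (Fin n → Maybe (Fin n')) → Fin n → (Fin n → Maybe (Fin n')) → Set
ExtendsAt f γ g =
  (∀ α a → f α ≡ just a → g α ≡ just a) ×
  (∃[ c ] g γ ≡ just c) ×
  (∀ α → f α ≡ nothing → ¬ (α ≡ γ) → g α ≡ nothing)

IsExtendable : ∀ {n m n' m'} → CoherentConfiguration n m → CoherentConfiguration n' m'
             → Permutation m m' → (Fin n → Maybe (Fin n')) → Set
IsExtendable X X' φ f =
  ∀ γ → ∃[ g ] ExtendsAt f γ g × IsFaithful X X' φ g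

record IsPermGroup {n : ℕ} (G : Permutation′ n → Set) : Set where
  field
    id-mem : G id
    ∘-mem  : ∀ g h → G g → G h → G (g ∘ₚ h)
    inv-mem : ∀ g → G g → G (flip g)

IsSchurian : ∀ {n m} → CoherentConfiguration n m → Set₁
IsSchurian {n} X =
  ∃[ G ] IsPermGroup {n} G ×
    (∀ α β γ δ → R X α β ≡ R X γ δ →
       ∃[ g ] G g × (g ⟨$⟩ʳ α ≡ γ) × (g ⟨$⟩ʳ β ≡ δ)) ×
    (∀ g α β → G g → R X (g ⟨$⟩ʳ α) (g ⟨$⟩ʳ β) ≡ R X α β)

IsSeparable : ∀ {n m} → CoherentConfiguration n m → Set
IsSeparable {n} {m} X =
  ∀ {n' m'} (X' : CoherentConfiguration n' m') → IsCoherent X' →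
  ∀ (φ : Permutation m m') → IsAlgebraicIso X X' φ →
  ∃[ f ] (∀ α β → R X' (f ⟨$⟩ʳ α) (f ⟨$⟩ʳ β) ≡ φ ⟨$⟩ʳ R X α β)

-- Call h : Ω → Ω' an inducing map for an algebraic isomorphism φ when
-- r'(h α, h β) = φ(r(α,β)) for all α, β.  The proof has three ingredients.
--  * Extension: if every φ-faithful partial map is φ-extendable, then any
--    φ-faithful partial map f extends, one point at a time, to a total map
--    inducing φ.
--  * Bijectivity: a total map inducing φ is injective (1_Ω is a union of basis
--    relations) and surjective: a point c outside the image would be an extra
--    element of a set counted by an intersection number, which φ preserves.
--    So it is a bijection Ω → Ω' (a Permutation).
--  * Two-point maps: if r(α,β) = r(γ,δ) then {α ↦ γ, β ↦ δ} is faithful for the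
--    identity algebraic isomorphism; this uses that the colours of the loops at
--    the endpoints of a pair are determined by the colour of the pair.
-- Separability is the extension of the empty map for an arbitrary φ; schurity
-- follows by extending two-point maps to automorphisms, so that the basis
-- relations are exactly the orbits of the automorphism group on Ω × Ω.
module Submission where

open import Defs
open import Data.Nat using (suc; _≤_; z≤n; s≤s)
open import Data.Nat.Properties using (≤-trans; ≤-reflexive; n≮n)
open import Data.Fin using (Fin; _≟_)
open import Data.Fin.Permutation
  using (Permutation; Permutation′; _⟨$⟩ʳ_; _⟨$⟩ˡ_; inverseʳ; inverseˡ; permutation; id)
open import Data.List using (List; []; _∷_; length; filter; allFin; map)
open import Data.List.Properties using (length-map; length-removeAt′)
open import Data.List.Relation.Unary.Any using (here; there; _─_)
import Data.List.Relation.Unary.All as All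
open import Data.List.Relation.Unary.All.Properties using (¬Any⇒All¬)
open import Data.List.Relation.Unary.AllPairs using (_∷_)
open import Data.List.Relation.Unary.Unique.Propositional using (Unique)
import Data.List.Relation.Unary.Unique.Propositional.Properties as Unique
open import Data.List.Membership.Propositional using (_∈_)
open import Data.List.Membership.Propositional.Properties
  using (∈-filter⁺; ∈-filter⁻; ∈-allFin; ∈-map⁻)
import Data.List.Membership.DecPropositional as DecMembership
open import Data.List.Relation.Binary.Subset.Propositional using (_⊆_)
open import Data.Maybe using (Maybe; just; nothing)
open import Data.Maybe.Properties using (just-injective)
open import Data.Product using (∃-syntax; _×_; _,_; proj₁; proj₂)
open import Data.Sum using (_⊎_; inj₁; inj₂)
open import Data.Empty using (⊥-elim)
open import Relation.Nullary using (yes; no; ¬_)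
open import Relation.Nullary.Decidable using (_×-dec_)
open import Relation.Binary.PropositionalEquality

∈-─ : ∀ {A : Set} {x y : A} {xs} (x∈xs : x ∈ xs) → y ∈ xs → y ≢ x → y ∈ (xs ─ x∈xs)
∈-─ (here refl) (here refl)  y≢x = ⊥-elim (y≢x refl)
∈-─ (here refl) (there y∈xs) _   = y∈xs
∈-─ (there _)   (here refl)  _   = here refl
∈-─ (there x∈xs) (there y∈xs) y≢x = there (∈-─ x∈xs y∈xs y≢x)

unique-⊆⇒length≤ : ∀ {A : Set} {xs ys : List A} → Unique xs → xs ⊆ ys → length xs ≤ length ys
unique-⊆⇒length≤ {xs = []}     _            _  = z≤n
unique-⊆⇒length≤ {xs = x ∷ xs} {ys} (x∉xs ∷ xs!) xs⊆ys =
  ≤-trans (s≤s (unique-⊆⇒length≤ xs! xs⊆ys─x)) (≤-reflexive (sym (length-removeAt′ ys _)))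
  where
  x∈ys : x ∈ ys
  x∈ys = xs⊆ys (here refl)
  xs⊆ys─x : xs ⊆ (ys ─ x∈ys)
  xs⊆ys─x y∈xs = ∈-─ x∈ys (xs⊆ys (there y∈xs)) (λ y≡x → All.lookup x∉xs y∈xs (sym y≡x))

inhabited-by-length : ∀ {A B : Set} {x : A} {xs : List A} {ys : List B} →
  x ∈ xs → length xs ≡ length ys → ∃[ y ] y ∈ ys
inhabited-by-length {ys = y ∷ _} _ _ = y , here refl
inhabited-by-length {xs = _ ∷ _} {ys = []} _ ()

between : ∀ {n m} → CoherentConfiguration n m → Fin n → Fin n → Fin m → Fin m → List (Fin n)
between X α β r s = filter (λ γ → (R X α γ ≟ r) ×-dec (R X γ β ≟ s)) (allFin _)

module _ {n m} (X : CoherentConfiguration n m) where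

  ∈-between⁺ : ∀ {α β γ r s} → R X α γ ≡ r → R X γ β ≡ s → γ ∈ between X α β r s
  ∈-between⁺ αγ≡r γβ≡s = ∈-filter⁺ _ (∈-allFin _) (αγ≡r , γβ≡s)

  ∈-between⁻ : ∀ {α β γ r s} → γ ∈ between X α β r s → R X α γ ≡ r × R X γ β ≡ s
  ∈-between⁻ γ∈ = proj₂ (∈-filter⁻ _ {xs = allFin n} γ∈)

  count-invariant : IsCoherent X → ∀ {α β γ δ} r s → R X α β ≡ R X γ δ →
    count X α β r s ≡ count X γ δ r s
  count-invariant coh {α} {β} {γ} {δ} r s eq with coh r s (R X α β)
  ... | _ , isC = trans (isC α β refl) (sym (isC γ δ (sym eq)))

  triangle-transfer : IsCoherent X → ∀ {α β γ δ ε} → R X α β ≡ R X γ δ →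
    ∃[ ε′ ] R X γ ε′ ≡ R X α ε × R X ε′ δ ≡ R X ε β
  triangle-transfer coh {ε = ε} eq
    with ε′ , ε′∈ ← inhabited-by-length (∈-between⁺ refl refl) (count-invariant coh _ _ eq)
    = ε′ , ∈-between⁻ ε′∈

  source-loop : IsCoherent X → ∀ {α β γ δ} → R X α β ≡ R X γ δ → R X γ γ ≡ R X α α
  source-loop coh {α} {γ = γ} eq with triangle-transfer coh {ε = α} eq
  ... | ε′ , γε′≡αα , _ with diagonal X α γ ε′ (sym γε′≡αα)
  ... | refl = γε′≡αα

  target-loop : IsCoherent X → ∀ {α β γ δ} → R X α β ≡ R X γ δ → R X δ δ ≡ R X β β
  target-loop coh {β = β} {δ = δ} eq with triangle-transfer coh {ε = β} eq
  ... | ε′ , _ , ε′δ≡ββ with diagonal X β ε′ δ (sym ε′δ≡ββ)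
  ... | refl = ε′δ≡ββ

  converse-colour : ∀ {α β γ δ} → R X α β ≡ R X γ δ → R X β α ≡ R X δ γ
  converse-colour {α} {β} {γ} {δ} eq with converse X (R X α β)
  ... | _ , reverse , _ = trans (reverse α β refl) (sym (reverse γ δ (sym eq)))

Induces : ∀ {n m n′ m′} → CoherentConfiguration n m → CoherentConfiguration n′ m′ →
  Permutation m m′ → (Fin n → Fin n′) → Set
Induces X X′ φ h = ∀ α β → R X′ (h α) (h β) ≡ φ ⟨$⟩ʳ R X α β

Aut : ∀ {n m} → CoherentConfiguration n m → Permutation′ n → Set
Aut X g = Induces X X id (g ⟨$⟩ʳ_)

Aut-isPermGroup : ∀ {n m} (X : CoherentConfiguration n m) → IsPermGroup (Aut X)
Aut-isPermGroup X = record
  { id-mem  = λ _ _ → refl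
  ; ∘-mem   = λ g h g∈ h∈ α β → trans (h∈ _ _) (g∈ α β)
  ; inv-mem = λ g g∈ α β → trans (sym (g∈ _ _)) (cong₂ (R X) (inverseʳ g) (inverseʳ g))
  }

id-isAlgebraicIso : ∀ {n m} (X : CoherentConfiguration n m) → IsAlgebraicIso X X id
id-isAlgebraicIso X _ _ _ _ c-is = c-is

module _ {n m n′ m′} (X : CoherentConfiguration n m) (X′ : CoherentConfiguration n′ m′)
         (φ : Permutation m m′) where

  -- A map inducing φ is injective, since 1_Ω is a union of basis relations.
  induces⇒injective : ∀ {h} → Induces X X′ φ h → ∀ α β → h α ≡ h β → α ≡ β
  induces⇒injective {h} ind α β hα≡hβ = diagonal X α α β (sym (φ-injective φαβ≡φαα))
    where
    φ-injective : ∀ {r s} → φ ⟨$⟩ʳ r ≡ φ ⟨$⟩ʳ s → r ≡ s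
    φ-injective e = trans (sym (inverseˡ φ)) (trans (cong (φ ⟨$⟩ˡ_) e) (inverseˡ φ))
    φαβ≡φαα : φ ⟨$⟩ʳ R X α β ≡ φ ⟨$⟩ʳ R X α α
    φαβ≡φαα = begin
      φ ⟨$⟩ʳ R X α β    ≡⟨ sym (ind α β) ⟩
      R X′ (h α) (h β)  ≡⟨ cong (R X′ (h α)) (sym hα≡hβ) ⟩
      R X′ (h α) (h α)  ≡⟨ ind α α ⟩
      φ ⟨$⟩ʳ R X α α    ∎
      where open ≡-Reasoning

  -- A map inducing an algebraic isomorphism is surjective: for a = h α₀ and
  -- r, s the colours pulled back from (a,c), (c,a), h maps α₀ r ∩ α₀ s*
  -- injectively into a φ(r) ∩ a φ(s)*, a set of the same size containing c,
  -- so c is in the image.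
  module Surjectivity (coh : IsCoherent X) (iso : IsAlgebraicIso X X′ φ)
                      {h} (ind : Induces X X′ φ h) (c : Fin n′) (α₀ : Fin n) where

    r s : Fin m
    r = φ ⟨$⟩ˡ R X′ (h α₀) c
    s = φ ⟨$⟩ˡ R X′ c (h α₀)

    L L′ : List (Fin n′)
    L  = map h (between X α₀ α₀ r s)
    L′ = between X′ (h α₀) (h α₀) (φ ⟨$⟩ʳ r) (φ ⟨$⟩ʳ s)

    |L′|≡|L| : length L′ ≡ length L
    |L′|≡|L| with k , isK ← coh r s (R X α₀ α₀) = begin
      length L′                      ≡⟨ iso r s _ k isK _ _ (ind α₀ α₀) ⟩
      k                              ≡⟨ sym (isK α₀ α₀ refl) ⟩
      length (between X α₀ α₀ r s)   ≡⟨ sym (length-map h (between X α₀ α₀ r s)) ⟩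
      length L                       ∎
      where open ≡-Reasoning

    L⊆L′ : L ⊆ L′
    L⊆L′ hγ∈L with γ , γ∈L , refl ← ∈-map⁻ h hγ∈L
      with α₀γ≡r , γα₀≡s ← ∈-between⁻ X γ∈L
      = ∈-between⁺ X′ (trans (ind α₀ γ) (cong (φ ⟨$⟩ʳ_) α₀γ≡r))
                      (trans (ind γ α₀) (cong (φ ⟨$⟩ʳ_) γα₀≡s))

    c∈L′ : c ∈ L′
    c∈L′ = ∈-between⁺ X′ (sym (inverseʳ φ)) (sym (inverseʳ φ))

    L! : Unique L
    L! = Unique.map⁺ (induces⇒injective ind _ _) (Unique.filter⁺ _ (Unique.allFin⁺ n))

    -- If c were not in L, then c ∷ L would fit into L′, which has the size of L.
    c∉L⇒too-long : ¬ c ∈ L → suc (length L) ≤ length L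
    c∉L⇒too-long c∉L =
      ≤-trans (unique-⊆⇒length≤ (¬Any⇒All¬ _ c∉L ∷ L!) c∷L⊆L′) (≤-reflexive |L′|≡|L|)
      where
      c∷L⊆L′ : c ∷ L ⊆ L′
      c∷L⊆L′ (here refl) = c∈L′
      c∷L⊆L′ (there y∈L) = L⊆L′ y∈L

    c∈L : c ∈ L
    c∈L with DecMembership._∈?_ _≟_ c L
    ... | yes c∈L = c∈L
    ... | no  c∉L = ⊥-elim (n≮n _ (c∉L⇒too-long c∉L))

  -- Ω is nonempty as soon as Ω' is (the basis relation φ⁻¹(r'(c,c)) has a
  -- point), so the argument above applies to every c.
  induces⇒surjective : IsCoherent X → IsAlgebraicIso X X′ φ →
    ∀ {h} → Induces X X′ φ h → ∀ c → ∃[ α ] h α ≡ c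
  induces⇒surjective coh iso {h} ind c
    with α₀ , _ ← nonempty X (φ ⟨$⟩ˡ R X′ c c)
    with γ , _ , c≡hγ ← ∈-map⁻ h (Surjectivity.c∈L coh iso ind c α₀)
    = γ , sym c≡hγ

  inducing-permutation : IsCoherent X → IsAlgebraicIso X X′ φ →
    ∀ {h} → Induces X X′ φ h → ∃[ P ] (∀ α → P ⟨$⟩ʳ α ≡ h α)
  inducing-permutation coh iso {h} ind =
    permutation h h⁻¹ (λ c → proj₂ (onto c)) (λ α → induces⇒injective ind _ _ (proj₂ (onto (h α)))) ,
    λ _ → refl
    where
    onto : ∀ c → ∃[ α ] h α ≡ c
    onto = induces⇒surjective coh iso ind
    h⁻¹ : Fin n′ → Fin n
    h⁻¹ c = proj₁ (onto c)

_⊑_ : ∀ {n n′} → (Fin n → Maybe (Fin n′)) → (Fin n → Maybe (Fin n′)) → Set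
f ⊑ g = ∀ α a → f α ≡ just a → g α ≡ just a

AllExtendable : ∀ {n m n′ m′} → CoherentConfiguration n m → CoherentConfiguration n′ m′ →
  Permutation m m′ → Set
AllExtendable {n} {n′ = n′} X X′ φ =
  ∀ (f : Fin n → Maybe (Fin n′)) → IsFaithful X X′ φ f → IsExtendable X X′ φ f

module _ {n m n′ m′} (X : CoherentConfiguration n m) (X′ : CoherentConfiguration n′ m′)
         (φ : Permutation m m′) (extendable : AllExtendable X X′ φ) where

  extend-over : ∀ f → IsFaithful X X′ φ f → (xs : List (Fin n)) →
    ∃[ g ] IsFaithful X X′ φ g × f ⊑ g × (∀ γ → γ ∈ xs → ∃[ c ] g γ ≡ just c)
  extend-over f f-faithful [] = f , f-faithful , (λ _ _ fα≡a → fα≡a) , λ _ ()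
  extend-over f f-faithful (x ∷ xs)
    with g , g-faithful , f⊑g , g-defined ← extend-over f f-faithful xs
    with g′ , (g⊑g′ , (c , g′x≡c) , _) , g′-faithful ← extendable g g-faithful x
    = g′ , g′-faithful , (λ α a fα≡a → g⊑g′ α a (f⊑g α a fα≡a)) , defined
    where
    defined : ∀ γ → γ ∈ x ∷ xs → ∃[ c ] g′ γ ≡ just c
    defined _ (here refl) = c , g′x≡c
    defined γ (there γ∈xs) with d , gγ≡d ← g-defined γ γ∈xs = d , g⊑g′ γ d gγ≡d

  extend-to-total : ∀ f → IsFaithful X X′ φ f →
    ∃[ h ] Induces X X′ φ h × (∀ α a → f α ≡ just a → h α ≡ a)
  extend-to-total f f-faithful
    with g , (_ , g-faithful) , f⊑g , g-defined ← extend-over f f-faithful (allFin n)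
    = h , (λ α β → sym (g-faithful α β (h α) (h β) (gh α) (gh β))) ,
      λ α a fα≡a → just-injective (trans (sym (gh α)) (f⊑g α a fα≡a))
    where
    h : Fin n → Fin n′
    h α = proj₁ (g-defined α (∈-allFin α))
    gh : ∀ α → g α ≡ just (h α)
    gh α = proj₂ (g-defined α (∈-allFin α))

  extend-to-isomorphism : IsCoherent X → IsAlgebraicIso X X′ φ → ∀ f → IsFaithful X X′ φ f →
    ∃[ P ] Induces X X′ φ (P ⟨$⟩ʳ_) × (∀ α a → f α ≡ just a → P ⟨$⟩ʳ α ≡ a)
  extend-to-isomorphism coh iso f f-faithful
    with h , ind , f⊑h ← extend-to-total f f-faithful
    with P , P≡h ← inducing-permutation X X′ φ coh iso ind
    = P , (λ α β → trans (cong₂ (R X′) (P≡h α) (P≡h β)) (ind α β)) ,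
      λ α a fα≡a → trans (P≡h α) (f⊑h α a fα≡a)

module TwoPoint {n m} (X : CoherentConfiguration n m) (coh : IsCoherent X)
                {α β γ δ : Fin n} (eq : R X α β ≡ R X γ δ) where

  pairMap : Fin n → Maybe (Fin n)
  pairMap x with x ≟ α
  ... | yes _ = just γ
  ... | no _ with x ≟ β
  ...   | yes _ = just δ
  ...   | no _  = nothing

  pairMap-graph : ∀ x a → pairMap x ≡ just a → (x ≡ α × a ≡ γ) ⊎ (x ≡ β × a ≡ δ)
  pairMap-graph x a e with x ≟ α
  ... | yes x≡α = inj₁ (x≡α , sym (just-injective e))
  ... | no _ with x ≟ β
  ...   | yes x≡β = inj₂ (x≡β , sym (just-injective e))
  pairMap-graph x a () | no _ | no _

  pairMap-α : pairMap α ≡ just γ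
  pairMap-α with α ≟ α
  ... | yes _ = refl
  ... | no α≢α = ⊥-elim (α≢α refl)

  -- If α = β then r(α,β) is a loop colour, so also γ = δ.
  pairMap-β : pairMap β ≡ just δ
  pairMap-β with β ≟ α
  ... | yes refl = cong just (diagonal X β γ δ eq)
  ... | no _ with β ≟ β
  ...   | yes _ = refl
  ...   | no β≢β = ⊥-elim (β≢β refl)

  pairMap-faithful : IsFaithful X X id pairMap
  pairMap-faithful = injective , preserves
    where
    γ≡δ⇒α≡β : γ ≡ δ → α ≡ β
    γ≡δ⇒α≡β refl = diagonal X γ α β (sym eq)

    injective : IsPartialInjection pairMap
    injective x y a ex ey with pairMap-graph x a ex | pairMap-graph y a ey
    ... | inj₁ (refl , _) | inj₁ (refl , _) = refl
    ... | inj₂ (refl , _) | inj₂ (refl , _) = refl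
    ... | inj₁ (refl , a≡γ) | inj₂ (refl , a≡δ) = γ≡δ⇒α≡β (trans (sym a≡γ) a≡δ)
    ... | inj₂ (refl , a≡δ) | inj₁ (refl , a≡γ) = sym (γ≡δ⇒α≡β (trans (sym a≡γ) a≡δ))

    preserves : ∀ x y a b → pairMap x ≡ just a → pairMap y ≡ just b → R X x y ≡ R X a b
    preserves x y a b ex ey with pairMap-graph x a ex | pairMap-graph y b ey
    ... | inj₁ (refl , refl) | inj₁ (refl , refl) = sym (source-loop X coh eq)
    ... | inj₁ (refl , refl) | inj₂ (refl , refl) = eq
    ... | inj₂ (refl , refl) | inj₁ (refl , refl) = converse-colour X eq
    ... | inj₂ (refl , refl) | inj₂ (refl , refl) = sym (target-loop X coh eq)

Aut-transitive : ∀ {n m} (X : CoherentConfiguration n m) → IsCoherent X → AllExtendable X X id →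
  ∀ α β γ δ → R X α β ≡ R X γ δ → ∃[ g ] Aut X g × (g ⟨$⟩ʳ α ≡ γ) × (g ⟨$⟩ʳ β ≡ δ)
Aut-transitive X coh extendable α β γ δ eq
  with g , g∈Aut , extends ← extend-to-isomorphism X X id extendable coh (id-isAlgebraicIso X)
                               (TwoPoint.pairMap X coh eq) (TwoPoint.pairMap-faithful X coh eq)
  = g , g∈Aut , extends α γ (TwoPoint.pairMap-α X coh eq) , extends β δ (TwoPoint.pairMap-β X coh eq)

corollary2p2 : ∀ {n m} (X : CoherentConfiguration n m) → IsCoherent X →
    (∀ {n' m'} (X' : CoherentConfiguration n' m') → IsCoherent X' →
    ∀ (φ : Permutation m m') → IsAlgebraicIso X X' φ →
    ∀ (f : Fin n → Maybe (Fin n')) → IsFaithful X X' φ f → IsExtendable X X' φ f) →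
    IsSchurian X × IsSeparable X
corollary2p2 X coh hyp = schurian , separable
  where
  schurian : IsSchurian X
  schurian = Aut X , Aut-isPermGroup X ,
             Aut-transitive X coh (hyp X coh id (id-isAlgebraicIso X)) ,
             λ _ _ _ g∈Aut → g∈Aut _ _

  separable : IsSeparable X
  separable X′ coh′ φ iso
    with P , ind , _ ← extend-to-isomorphism X X′ φ (hyp X′ coh′ φ iso) coh iso
                         (λ _ → nothing) ((λ _ _ _ ()) , (λ _ _ _ _ ()))
    = P , ind
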